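{- Let $U\subseteq\mathbb{N}$ be avoidable with respect to $(\mathbb{N},+)$ and suppose $U$ contains infinitely many even numbers. Then $U$ has arithmetic density $0$, i.e. $d(U)=\limsup_{n\to\infty}\frac{U(n)}{n}=0$, where $U(n)$ is the number of elements of $U$ less than $n$.
   Context: For a set $S$ with a binary operation, a subset $U\subseteq S$ is avoidable if there is a partition $\{A,B\}$ of $S$ such that no element of $U$ is the product (here: sum) of two distinct elements of $A$ or of two distinct elements of $B$. Here $S=\mathbb{N}$ with ordinary addition. -}

module Defs where

open import Data.Nat using (ℕ; zero; suc; _+_; _*_; _≤_)
open import Data.Nat.Divisibility using (_∣_)
open import Data.Bool using (Bool; true; false)
open import Data.Product using (Σ; _×_; ∃-syntax)
open import Relation.Binary.PropositionalEquality using (_≡_; _≢_)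

Subset : Set
Subset = ℕ → Bool

-- The ambient set is ℕ = {1,2,3,...}; a subset U of it has U 0 ≡ false.
PositiveSubset : Subset → Set
PositiveSubset U = U 0 ≡ false

-- A partition {A,B} of ℕ = {1,2,...} is given by a colouring c with
-- A = {a ≥ 1 | c a ≡ true}, B = {b ≥ 1 | c b ≡ false}, both nonempty.
Avoidable : Subset → Set
Avoidable U =
  Σ (ℕ → Bool) λ c →
    (∃[ a ] (1 ≤ a × c a ≡ true)) ×
    (∃[ b ] (1 ≤ b × c b ≡ false)) ×
    (∀ a b → 1 ≤ a → 1 ≤ b → a ≢ b → c a ≡ c b → U (a + b) ≡ false)

InfinitelyManyEven : Subset → Set
InfinitelyManyEven U = ∀ m → ∃[ n ] (m ≤ n × 2 ∣ n × U n ≡ true)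

count : Subset → ℕ → ℕ
count U zero = zero
count U (suc n) with U n
... | true  = suc (count U n)
... | false = count U n

-- d(U) = limsup U(n)/n = 0, i.e. for every ε = 1/k > 0 we eventually have
-- U(n)/n ≤ 1/k (equivalently k * U(n) ≤ n).
DensityZero : Subset → Set
DensityZero U = ∀ k → 1 ≤ k → ∃[ N ] (∀ n → N ≤ n → k * count U n ≤ n)

-- If 2t ∈ U, then two elements x < x + 2s of U with x > 2t and 0 < s < t are
-- impossible: a = t − s < b = t + s < c = x − t + s are distinct positive numbers
-- whose pairwise sums 2t, x, x + 2s all lie in U, yet two of them get the same
-- colour. Of any three numbers two differ by an even amount, so every window
-- [n, n + 2t) with n > 2t holds at most two elements of U, giving U upper density
-- at most 1/t; and t can be taken arbitrarily large.
module Submission where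

open import Algebra.Properties.CommutativeSemigroup using (xy∙z≈xz∙y)
open import Data.Bool using (Bool; true; false)
open import Data.Bool.Properties using (¬-not)
open import Data.Empty using (⊥)
open import Data.Nat
open import Data.Nat.Divisibility using (divides)
open import Data.Nat.Induction using (<-rec)
open import Data.Nat.Properties
open import Data.Nat.Tactic.RingSolver using (solve-∀)
open import Data.Product using (_,_; _×_; ∃-syntax)
open import Data.Sum using (_⊎_; inj₁; inj₂)
open import Function using (_∘_)
open import Relation.Binary.PropositionalEquality
open import Relation.Nullary using (yes; no)

open import Defs

count-≤ : ∀ U n → count U n ≤ n
count-≤ U zero = z≤n
count-≤ U (suc n) with U n
... | true  = s≤s (count-≤ U n)
... | false = m≤n⇒m≤1+n (count-≤ U n)

count-≤-suc : ∀ U n → count U n ≤ count U (suc n)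
count-≤-suc U n with U n
... | true  = n≤1+n (count U n)
... | false = ≤-refl

count-mono : ∀ U {m n} → m ≤ n → count U m ≤ count U n
count-mono U {n = zero} z≤n = ≤-refl
count-mono U {n = suc n} m≤1+n with m≤n⇒m<n∨m≡n m≤1+n
... | inj₁ m<1+n = ≤-trans (count-mono U (≤-pred m<1+n)) (count-≤-suc U n)
... | inj₂ refl  = ≤-refl

count-suc-member : ∀ U {x} → U x ≡ true → count U (suc x) ≡ suc (count U x)
count-suc-member U Ux rewrite Ux = refl

last-member : ∀ U m → 0 < count U m →
              ∃[ x ] (x < m × U x ≡ true × count U m ≡ suc (count U x))
last-member U (suc m) pos with U m in Um
... | true  = m , ≤-refl , Um , refl
... | false with last-member U m pos
...   | x , x<m , Ux , eq = x , m<n⇒m<1+n x<m , Ux , eq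

last-member-above : ∀ U {n m} k → k + count U n < count U m →
                    ∃[ x ] (n ≤ x × x < m × U x ≡ true × k + count U n ≤ count U x)
last-member-above U {n} {m} k more with last-member U m (≤-<-trans z≤n more)
... | x , x<m , Ux , eq = x , ≮⇒≥ x≮n , x<m , Ux , ≤-pred (subst (k + count U n <_) eq more)
  where
  x≮n : x ≮ n
  x≮n x<n = <⇒≱ (≤-<-trans (m≤n+m (count U n) k) more) (begin
    count U m        ≡⟨ eq ⟩
    suc (count U x)  ≡⟨ count-suc-member U Ux ⟨
    count U (suc x)  ≤⟨ count-mono U x<n ⟩
    count U n        ∎)
    where open ≤-Reasoning

three-members : ∀ U {n m} → 2 + count U n < count U m →
                ∃[ x ] ∃[ y ] ∃[ z ] (n ≤ x × x < y × y < z × z < m ×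
                                      U x ≡ true × U y ≡ true × U z ≡ true)
three-members U {n} more with last-member-above U {n} 2 more
... | z , _ , z<m , Uz , more₂ with last-member-above U {n} 1 more₂
... | y , _ , y<z , Uy , more₁ with last-member-above U {n} 0 more₁
... | x , n≤x , x<y , Ux , _ = x , y , z , n≤x , x<y , y<z , z<m , Ux , Uy , Uz

even⊎odd : ∀ n → (∃[ s ] n ≡ 2 * s) ⊎ (∃[ s ] n ≡ suc (2 * s))
even⊎odd zero = inj₁ (0 , refl)
even⊎odd (suc n) with even⊎odd n
... | inj₁ (s , refl) = inj₂ (s , refl)
... | inj₂ (s , refl) = inj₁ (suc s , cong suc (sym (+-suc s (s + 0))))

EvenGap : ℕ → ℕ → Set
EvenGap p q = ∃[ s ] q ≡ p + 2 * s

even-gap-among : ∀ {x y z} → x ≤ y → y ≤ z → EvenGap x y ⊎ EvenGap y z ⊎ EvenGap x z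
even-gap-among {x} x≤y y≤z
  with m≤n⇒∃[o]m+o≡n x≤y | m≤n⇒∃[o]m+o≡n y≤z
... | d₁ , refl | d₂ , refl with even⊎odd d₁ | even⊎odd d₂
... | inj₁ (s , refl) | _               = inj₁ (s , refl)
... | inj₂ _          | inj₁ (s , refl) = inj₂ (inj₁ (s , refl))
... | inj₂ (s₁ , refl) | inj₂ (s₂ , refl) = inj₂ (inj₂ (suc (s₁ + s₂) , odd+odd x s₁ s₂))
  where
  odd+odd : ∀ x s₁ s₂ → x + suc (2 * s₁) + suc (2 * s₂) ≡ x + 2 * suc (s₁ + s₂)
  odd+odd = solve-∀

Avoids : (ℕ → Bool) → Subset → Set
Avoids χ U = ∀ a b → 1 ≤ a → 1 ≤ b → a ≢ b → χ a ≡ χ b → U (a + b) ≡ false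

module _ {χ : ℕ → Bool} {U : Subset} (avoids : Avoids χ U) where

  member-sum-colours-differ : ∀ {a b} → 0 < a → a < b → U (a + b) ≡ true → χ a ≢ χ b
  member-sum-colours-differ {a} {b} 0<a a<b Uab χa≡χb with () ←
    trans (sym Uab) (avoids a b 0<a (<-trans 0<a a<b) (<⇒≢ a<b) χa≡χb)

  no-member-triangle : ∀ {a b c} → 0 < a → a < b → b < c →
                       U (a + b) ≡ true → U (b + c) ≡ true → U (a + c) ≡ true → ⊥
  no-member-triangle 0<a a<b b<c Uab Ubc Uac =
    member-sum-colours-differ 0<a (<-trans a<b b<c) Uac
      (trans (¬-not χa≢χb) (sym (¬-not (χb≢χc ∘ sym))))
    where
    χa≢χb = member-sum-colours-differ 0<a a<b Uab
    χb≢χc = member-sum-colours-differ (<-trans 0<a a<b) b<c Ubc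

  module _ (t : ℕ) (U2t : U (2 * t) ≡ true) where

    no-short-even-gap : ∀ {x s} → 2 * t < x → 0 < s → s < t →
                        U x ≡ true → U (x + 2 * s) ≡ true → ⊥
    no-short-even-gap {s = s} 2t<x 0<s s<t Ux Ux+2s
      with m≤n⇒∃[o]m+o≡n s<t | m≤n⇒∃[o]m+o≡n 2t<x
    ... | a₀ , refl | r₀ , refl =
      no-member-triangle {a} {a + 2 * s} {a + 2 * s + r} (s≤s z≤n)
        (m<m+n a (*-monoʳ-< 2 0<s)) (m<m+n (a + 2 * s) (s≤s z≤n))
        (subst (λ w → U w ≡ true) (2t≡a+b a₀ s) U2t)
        (subst (λ w → U w ≡ true) (x+2s≡b+c a₀ s r₀) Ux+2s)
        (subst (λ w → U w ≡ true) (x≡a+c a₀ s r₀) Ux)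
      where
      a = suc a₀
      r = suc r₀
      2t≡a+b : ∀ a₀ s → 2 * (suc s + a₀) ≡ suc a₀ + (suc a₀ + 2 * s)
      2t≡a+b = solve-∀
      x+2s≡b+c : ∀ a₀ s r₀ → suc (2 * (suc s + a₀)) + r₀ + 2 * s
                         ≡ (suc a₀ + 2 * s) + (suc a₀ + 2 * s + suc r₀)
      x+2s≡b+c = solve-∀
      x≡a+c : ∀ a₀ s r₀ → suc (2 * (suc s + a₀)) + r₀ ≡ suc a₀ + (suc a₀ + 2 * s + suc r₀)
      x≡a+c = solve-∀

    no-even-gap-in-window : ∀ {n p q} → 2 * t < n →
                            n ≤ p → p < q → q < n + 2 * t →
                            U p ≡ true → U q ≡ true → EvenGap p q → ⊥
    no-even-gap-in-window {n} {p} 2t<n n≤p p<q q<n+2t Up Uq (s , refl) =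
      no-short-even-gap (<-≤-trans 2t<n n≤p) 0<s s<t Up Uq
      where
      0<s : 0 < s
      0<s = *-cancelˡ-< 2 0 s (+-cancelˡ-< p 0 (2 * s) (subst (_< p + 2 * s) (sym (+-identityʳ p)) p<q))
      s<t : s < t
      s<t = *-cancelˡ-< 2 s t (+-cancelˡ-< p (2 * s) (2 * t) (<-≤-trans q<n+2t (+-monoˡ-≤ (2 * t) n≤p)))

    no-three-in-window : ∀ {n x y z} → 2 * t < n →
                         n ≤ x → x < y → y < z → z < n + 2 * t →
                         U x ≡ true → U y ≡ true → U z ≡ true → ⊥
    no-three-in-window 2t<n n≤x x<y y<z z<n+2t Ux Uy Uz
      with even-gap-among (<⇒≤ x<y) (<⇒≤ y<z)
    ... | inj₁ gap        = no-even-gap-in-window 2t<n n≤x x<y (<-trans y<z z<n+2t) Ux Uy gap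
    ... | inj₂ (inj₁ gap) = no-even-gap-in-window 2t<n (≤-trans n≤x (<⇒≤ x<y)) y<z z<n+2t Uy Uz gap
    ... | inj₂ (inj₂ gap) = no-even-gap-in-window 2t<n n≤x (<-trans x<y y<z) z<n+2t Ux Uz gap

    at-most-two-per-window : ∀ {n} → 2 * t < n →
                             count U (n + 2 * t) ≤ 2 + count U n
    at-most-two-per-window 2t<n = ≮⇒≥ λ more →
      let x , y , z , n≤x , x<y , y<z , z<m , Ux , Uy , Uz = three-members U more
      in  no-three-in-window 2t<n n≤x x<y y<z z<m Ux Uy Uz

window-bound⇒linear-bound : ∀ (f : ℕ → ℕ) b t M → 0 < b * t → (∀ n → f n ≤ n) →
                            (∀ n → M ≤ n → f (n + b * t) ≤ b + f n) →
                            ∀ n → t * f n ≤ n + t * (M + b * t)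
window-bound⇒linear-bound f b t M 0<bt f≤id step = <-rec _ bound
  where
  L = b * t
  C = t * (M + L)
  open ≤-Reasoning

  bound : ∀ n → (∀ {m} → m < n → t * f m ≤ m + C) → t * f n ≤ n + C
  bound n rec with n <? M + L
  ... | yes n<M+L = begin
    t * f n  ≤⟨ *-monoʳ-≤ t (f≤id n) ⟩
    t * n    ≤⟨ *-monoʳ-≤ t (<⇒≤ n<M+L) ⟩
    C        ≤⟨ m≤n+m C n ⟩
    n + C    ∎
  ... | no n≮M+L with m≤n⇒∃[o]m+o≡n (≮⇒≥ n≮M+L)
  ... | j , refl = begin
    t * f (M + L + j)        ≡⟨ cong (λ m → t * f m) (xy∙z≈xz∙y +-commutativeSemigroup M L j) ⟩
    t * f (M + j + L)        ≤⟨ *-monoʳ-≤ t (step (M + j) (m≤m+n M j)) ⟩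
    t * (b + f (M + j))      ≡⟨ *-distribˡ-+ t b (f (M + j)) ⟩
    t * b + t * f (M + j)    ≤⟨ +-monoʳ-≤ (t * b) (rec (+-monoˡ-< j (m<m+n M 0<bt))) ⟩
    t * b + (M + j + C)      ≡⟨ regroup t b M j C ⟩
    M + L + j + C            ∎
    where
    regroup : ∀ t b M j C → t * b + (M + j + C) ≡ M + b * t + j + C
    regroup = solve-∀

linear-bound⇒eventually-≤ : ∀ {f : ℕ → ℕ} {t C} k → 2 * k ≤ t → (∀ n → t * f n ≤ n + C) →
                            ∀ n → C ≤ n → k * f n ≤ n
linear-bound⇒eventually-≤ {f} {t} {C} k 2k≤t bound n C≤n = *-cancelˡ-≤ 2 (begin
  2 * (k * f n)  ≡⟨ *-assoc 2 k (f n) ⟨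
  2 * k * f n    ≤⟨ *-monoˡ-≤ (f n) 2k≤t ⟩
  t * f n        ≤⟨ bound n ⟩
  n + C          ≤⟨ +-monoʳ-≤ n C≤n ⟩
  n + n          ≡⟨ cong (n +_) (+-identityʳ n) ⟨
  2 * n          ∎)
  where open ≤-Reasoning

even-member-≥ : ∀ {U} → InfinitelyManyEven U → ∀ m → ∃[ t ] (m ≤ t × U (2 * t) ≡ true)
even-member-≥ {U} evens m with evens (2 * m)
... | _ , 2m≤2t , divides t refl , U2t =
  t , *-cancelˡ-≤ 2 (subst (2 * m ≤_) (*-comm t 2) 2m≤2t) , subst (λ e → U e ≡ true) (*-comm t 2) U2t

theorem3p2 : (U : Subset) → PositiveSubset U → Avoidable U → InfinitelyManyEven U → DensityZero U
theorem3p2 U _ (χ , _ , _ , avoids) evens k 1≤k with even-member-≥ evens (2 * k)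
... | t , 2k≤t , U2t = t * (M + 2 * t) , linear-bound⇒eventually-≤ k 2k≤t linear-bound
  where
  M = suc (2 * t)
  0<2t : 0 < 2 * t
  0<2t = ≤-trans (≤-trans 1≤k (m≤m+n k _)) (≤-trans 2k≤t (m≤m+n t _))
  linear-bound : ∀ n → t * count U n ≤ n + t * (M + 2 * t)
  linear-bound = window-bound⇒linear-bound (count U) 2 t M 0<2t (count-≤ U)
                   (λ n → at-most-two-per-window avoids t U2t)
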